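{- If $V$ satisfies (BF), (Cm) and (Cn), then $V$ satisfies (DV): for every natural number $n$ there is a $V$-function $s$ such that for all $e\in\mathsf I_n$ we have $s(e)\in\mathsf I_{n+1}$ and $\varphi^V_{s(e)}(x_1,\dots,x_n,x_{n+1})\simeq\varphi^V_e(x_1,\dots,x_n)$.
   Context: Let $\mathsf c:\mathbb N^2\to\mathbb N$ be a bijection and $\mathsf p_1,\mathsf p_2$ the functions with $\mathsf p_1(\mathsf c(a,b))=a$, $\mathsf p_2(\mathsf c(a,b))=b$; $I^i_n(a_1,\dots,a_n)=a_i$ for $n\ge1$, $1\le i\le n$. $V$ is a countable set of partial functions with arguments and values in $\mathbb N$ (arities $n\ge0$); a $V$-function is a member of $V$; $V_n$ is the set of $n$-ary $V$-functions. For each $n\ge0$ a numbering is fixed: a set $\mathsf I_n\subseteq\mathbb N$ and a map $e\mapsto\varphi^V_e$ from $\mathsf I_n$ onto $V_n$. $t_1\simeq t_2$ means that for every assignment of numbers to the variables, both sides are undefined or both are defined and equal. (BF): $I^i_n$ (all $n\ge1$, $1\le i\le n$), $\mathsf c,\mathsf p_1,\mathsf p_2$ are $V$-functions. (Cm): for all $n,m_1,\dots,m_n$, with $m=\max_i m_i$, there is an $(n+1)$-ary $V$-function $s$ with $s(e,e_1,\dots,e_n)\in\mathsf I_m$ and $\varphi^V_{s(e,e_1,\dots,e_n)}(x_1,\dots,x_m)\simeq\varphi^V_e(\varphi^V_{e_1}(x_1,\dots,x_{m_1}),\dots,\varphi^V_{e_n}(x_1,\dots,x_{m_n}))$ for all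 $e\in\mathsf I_n$, $e_i\in\mathsf I_{m_i}$. (Cn): there is a $V$-function $s$ with $s(k)\in\mathsf I_0$ and $\varphi^V_{s(k)}\simeq k$ for all $k\in\mathbb N$. -}

module Defs where

open import Data.Nat using (ℕ; zero; suc; _≤_; _⊔_)
open import Data.Nat.Properties using (m≤m⊔n; m≤n⊔m; ≤-trans)
open import Data.Fin using (Fin; zero; suc; inject≤)
open import Data.Vec using (Vec; []; _∷_; lookup; tabulate; init)
open import Data.Product using (Σ; ∃; _×_; _,_)
open import Function.Bundles using (_⇔_)
import Data.Product
import Relation.Binary.PropositionalEquality
open import Relation.Binary.PropositionalEquality using (_≡_)

record PFun (n : ℕ) : Set₁ where
  field
    graph      : Vec ℕ n → ℕ → Set
    functional : ∀ xs {a b} → graph xs a → graph xs b → a ≡ b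
open PFun public

_≃_ : ∀ {n} → PFun n → PFun n → Set
f ≃ g = ∀ xs y → (graph f xs y ⇔ graph g xs y)

_⟨_⟩∈_ : ∀ {n} → PFun n → Vec ℕ n → (ℕ → Set) → Set
f ⟨ xs ⟩∈ P = ∃ λ v → graph f xs v × P v

maxF : ∀ n → (Fin n → ℕ) → ℕ
maxF zero    ms = 0
maxF (suc n) ms = ms zero ⊔ maxF n (λ i → ms (suc i))

maxF-ub : ∀ n (ms : Fin n → ℕ) (i : Fin n) → ms i ≤ maxF n ms
maxF-ub (suc n) ms zero    = m≤m⊔n (ms zero) _
maxF-ub (suc n) ms (suc i) =
  ≤-trans (maxF-ub n (λ j → ms (suc j)) i) (m≤n⊔m (ms zero) _)

restrict : ∀ {k m} → k ≤ m → Vec ℕ m → Vec ℕ k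
restrict p xs = tabulate (λ j → lookup xs (inject≤ j p))

-- The data of the setting: a pairing bijection c (with p₁, p₂) and,
-- for each arity n, a numbering e ↦ φ n e from I n ⊆ ℕ onto Vₙ.
-- V itself is the union over n of the images φ n [I n].
record Setting : Set₁ where
  field
    c     : ℕ → ℕ → ℕ
    c-inj : ∀ {a b a' b'} → c a b ≡ c a' b' → (a ≡ a') × (b ≡ b')
    c-sur : ∀ z → ∃ λ a → ∃ λ b → c a b ≡ z
    I     : ℕ → ℕ → Set
    φ     : (n : ℕ) → ℕ → PFun n -- φ n e = φ^V_e on e ∈ Iₙ (values outside Iₙ irrelevant)

module _ (S : Setting) where
  open Setting S

  -- f is an n-ary V-function (Vₙ = φ[Iₙ], partial functions taken extensionally)
  IsV : ∀ n → PFun n → Set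
  IsV n f = ∃ λ e → I n e × (φ n e ≃ f)

  proj : ∀ n → Fin n → PFun n
  proj n i = record { graph = λ xs y → lookup xs i ≡ y
                    ; functional = λ { xs _≡_.refl _≡_.refl → _≡_.refl } }

  cF : PFun 2
  cF = record { graph = λ { (a ∷ b ∷ []) y → c a b ≡ y }
              ; functional = λ { (a ∷ b ∷ []) _≡_.refl _≡_.refl → _≡_.refl } }

  p₁F : PFun 1
  p₁F = record { graph = λ { (z ∷ []) y → ∃ λ b → c y b ≡ z }
               ; functional = λ { (z ∷ []) (b , p) (b' , q) →
                   Data.Product.proj₁ (c-inj (Relation.Binary.PropositionalEquality.trans p (Relation.Binary.PropositionalEquality.sym q))) } }

  p₂F : PFun 1
  p₂F = record { graph = λ { (z ∷ []) y → ∃ λ a → c a y ≡ z }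
               ; functional = λ { (z ∷ []) (a , p) (a' , q) →
                   Data.Product.proj₂ (c-inj (Relation.Binary.PropositionalEquality.trans p (Relation.Binary.PropositionalEquality.sym q))) } }

  BF : Set
  BF = (∀ n (i : Fin n) → IsV n (proj n i)) × IsV 2 cF × IsV 1 p₁F × IsV 1 p₂F

  compGraph : ∀ n (ms : Fin n → ℕ) → ℕ → (Fin n → ℕ) → Vec ℕ (maxF n ms) → ℕ → Set
  compGraph n ms e es xs y =
    ∃ λ (ys : Vec ℕ n) →
      (∀ i → graph (φ (ms i) (es i)) (restrict (maxF-ub n ms i) xs) (lookup ys i))
      × graph (φ n e) ys y

  Cm : Set₁
  Cm = ∀ n (ms : Fin n → ℕ) → ∃ λ (s : PFun (suc n)) → IsV (suc n) s ×
         (∀ e (es : Fin n → ℕ) → I n e → (∀ i → I (ms i) (es i)) →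
           s ⟨ e ∷ tabulate es ⟩∈ (λ v → I (maxF n ms) v ×
             (∀ xs y → graph (φ (maxF n ms) v) xs y ⇔ compGraph n ms e es xs y)))

  Cn : Set₁
  Cn = ∃ λ (s : PFun 1) → IsV 1 s ×
         (∀ k → s ⟨ k ∷ [] ⟩∈ (λ v → I 0 v × (∀ y → graph (φ 0 v) [] y ⇔ y ≡ k)))

  DV : Set₁
  DV = ∀ n → ∃ λ (s : PFun 1) → IsV 1 s ×
         (∀ e → I n e → s ⟨ e ∷ [] ⟩∈ (λ v → I (suc n) v ×
           (∀ xs y → graph (φ (suc n) v) xs y ⇔ graph (φ n e) (init xs) y)))

module Submission where

-- Fix n, let π be an index of the projection I¹₂ and π′ one of
-- I¹ₙ₊₁.  For e ∈ Iₙ, (Cm) for the arities (n, n+1) produces, as the value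
-- s₂(π, e, π′) of a ternary V-function s₂, an index of
--     π(φₑ(x₁,…,xₙ), π′(x₁,…,xₙ₊₁))  =  φₑ(x₁,…,xₙ),
-- i.e. of φₑ with a dummy last argument.  So the required unary function is
--     e ↦ s₂(π, e, π′)  =  s₂(const_π(e), I¹₁(e), const_π′(e)),
-- a composition of V-functions, hence a V-function because (Cm) makes V
-- closed under composition.  Unary constants are V-functions since
-- x ↦ k is I¹₂(c_k, x) for the index c_k ∈ I₀ of the constant k given by (Cn).

open import Defs
open import Data.Nat using (ℕ; suc; _≤_)
open import Data.Nat.Properties using (n≤1+n; m≤n⇒m⊔n≡n)
open import Data.Fin using (Fin; zero; suc)
open import Data.Vec using (Vec; []; _∷_; lookup; tabulate; init)
open import Data.Vec.Properties using (tabulate∘lookup; tabulate-cong)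
open import Data.Product using (∃; _×_; _,_)
open import Function.Bundles using (mk⇔; Equivalence)
import Function.Properties.Equivalence as ⇔
open import Relation.Binary.PropositionalEquality
  using (_≡_; refl; sym; trans; cong; subst)

open Equivalence using (to; from)

restrict-init : ∀ n (p : n ≤ suc n) (xs : Vec ℕ (suc n)) → restrict p xs ≡ init xs
restrict-init 0       p (x ∷ [])     = refl
restrict-init (suc n) p (x ∷ y ∷ xs) = cong (x ∷_) (restrict-init n (n≤1+n n) (y ∷ xs))

lookup-ext : ∀ {n} (ys zs : Vec ℕ n) → (∀ i → lookup ys i ≡ lookup zs i) → ys ≡ zs
lookup-ext ys zs eq =
  trans (sym (tabulate∘lookup ys)) (trans (tabulate-cong eq) (tabulate∘lookup zs))

constF : ∀ m → ℕ → PFun m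
constF m k = record { graph = λ _ y → y ≡ k ; functional = λ _ p q → trans p (sym q) }

padded : ∀ {n} → PFun n → PFun (suc n)
padded f = record { graph = λ xs → graph f (init xs) ; functional = λ xs → functional f (init xs) }

-- The M-ary composition f(g₁(x₁,…,x_{m₁}), …, gₙ(x₁,…,x_{mₙ})), where every mᵢ ≤ M.
-- With ub = maxF-ub its graph is literally the relation compGraph used in (Cm).
compose : ∀ {n M} (ms : Fin n → ℕ) → (∀ i → ms i ≤ M) →
          PFun n → ((i : Fin n) → PFun (ms i)) → PFun M
compose ms ub f gs = record { graph = relation ; functional = single-valued }
  where
  relation : Vec ℕ _ → ℕ → Set
  relation xs y = ∃ λ ys → (∀ i → graph (gs i) (restrict (ub i) xs) (lookup ys i)) × graph f ys y

  -- the inner values are determined, hence so is the outer one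
  single-valued : ∀ xs {a b} → relation xs a → relation xs b → a ≡ b
  single-valued xs (ys , hs , ha) (zs , hs′ , hb) =
    functional f zs (subst (λ ws → graph f ws _) same-args ha) hb
    where
    same-args : ys ≡ zs
    same-args = lookup-ext ys zs (λ i → functional (gs i) _ (hs i) (hs′ i))

compose-cong : ∀ {n M} (ms : Fin n → ℕ) (ub : ∀ i → ms i ≤ M) {f f′ : PFun n}
               {gs gs′ : (i : Fin n) → PFun (ms i)} →
               f ≃ f′ → (∀ i → gs i ≃ gs′ i) →
               compose ms ub f gs ≃ compose ms ub f′ gs′
compose-cong ms ub f≃f′ gs≃gs′ xs y = mk⇔
  (λ { (ys , hs , h) → ys , (λ i → to (gs≃gs′ i _ _) (hs i)) , to (f≃f′ ys y) h })
  (λ { (ys , hs , h) → ys , (λ i → from (gs≃gs′ i _ _) (hs i)) , from (f≃f′ ys y) h })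

module _ (S : Setting) where
  open Setting S

  -- v is an index of f in arity m; note IsV m f is ∃ λ v → Index m v f.
  Index : ∀ m → ℕ → PFun m → Set
  Index m v f = I m v × (φ m v ≃ f)

  IsV-cong : ∀ {m} {f g : PFun m} → IsV S m f → f ≃ g → IsV S m g
  IsV-cong (v , Iv , φv≃f) f≃g = v , Iv , λ xs y → ⇔.trans (φv≃f xs y) (f≃g xs y)

  compose-isV : Cm S → ∀ n (ms : Fin n → ℕ) (f : PFun n) (gs : (i : Fin n) → PFun (ms i)) →
                IsV S n f → (∀ i → IsV S (ms i) (gs i)) →
                IsV S (maxF n ms) (compose ms (maxF-ub n ms) f gs)
  compose-isV cm n ms f gs (e , Ie , φe≃f) gs-isV with cm n ms
  ... | s , _ , spec = from-spec (spec e index Ie index-ok)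
    where
    index : Fin n → ℕ
    index i = let (eᵢ , _) = gs-isV i in eᵢ
    index-ok : ∀ i → I (ms i) (index i)
    index-ok i = let (_ , Ieᵢ , _) = gs-isV i in Ieᵢ

    from-spec : s ⟨ e ∷ tabulate index ⟩∈ (λ v → Index (maxF n ms) v
                  (compose ms (maxF-ub n ms) (φ n e) (λ i → φ (ms i) (index i)))) →
                IsV S (maxF n ms) (compose ms (maxF-ub n ms) f gs)
    from-spec (v , _ , Iv , φv≃comp) =
      v , Iv , λ xs y → ⇔.trans (φv≃comp xs y) (inner-cong xs y)
      where
      inner-cong : compose ms (maxF-ub n ms) (φ n e) (λ i → φ (ms i) (index i)) ≃
                   compose ms (maxF-ub n ms) f gs
      inner-cong = compose-cong ms (maxF-ub n ms)
                     {f = φ n e} {f′ = f} {gs = λ i → φ (ms i) (index i)} {gs′ = gs}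
                     φe≃f (λ i → let (_ , _ , φeᵢ≃gᵢ) = gs-isV i in φeᵢ≃gᵢ)

  -- Unary constants are V-functions: x ↦ k is I¹₂(c_k, x) with c_k the 0-ary index of k.
  constant-isV : BF S → Cm S → Cn S → ∀ k → IsV S 1 (constF 1 k)
  constant-isV (proj-isV , _) cm (_ , _ , const₀) k =
    IsV-cong {f = composite} {g = constF 1 k}
      (compose-isV cm 2 arities (proj S 2 zero) inner (proj-isV 2 zero) inner-isV)
      composite-is-constant
    where
    arities : Fin 2 → ℕ
    arities zero    = 0
    arities (suc _) = 1
    inner : (i : Fin 2) → PFun (arities i)
    inner zero    = constF 0 k
    inner (suc _) = proj S 1 zero
    inner-isV : ∀ i → IsV S (arities i) (inner i)
    inner-isV zero with const₀ k
    ... | _ , _ , Ic , hc = _ , Ic , λ { [] y → hc y }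
    inner-isV (suc zero) = proj-isV 1 zero

    composite : PFun 1
    composite = compose arities (maxF-ub 2 arities) (proj S 2 zero) inner

    composite-is-constant : composite ≃ constF 1 k
    composite-is-constant (x ∷ []) y = mk⇔ (λ { ((_ ∷ _) , hs , refl) → hs zero })
      (λ { refl → (k ∷ x ∷ []) , (λ { zero → refl ; (suc zero) → refl }) , refl })

  -- Arities and inner functions of I¹₂(f(x₁,…,xₙ), I¹ₙ₊₁(x₁,…,xₙ₊₁)).
  padArities : ℕ → Fin 2 → ℕ
  padArities n zero    = n
  padArities n (suc _) = suc n

  padInner : ∀ {n} → PFun n → (i : Fin 2) → PFun (padArities n i)
  padInner f zero    = f
  padInner f (suc _) = proj S _ zero

  compose-padding : ∀ {n} (f : PFun n) (ub : ∀ i → padArities n i ≤ suc n) →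
                    compose (padArities n) ub (proj S 2 zero) (padInner f) ≃ padded f
  compose-padding {n} f ub xs y = mk⇔ drop-dummy add-dummy
    where
    first-args : restrict (ub zero) xs ≡ init xs
    first-args = restrict-init n (ub zero) xs

    drop-dummy : graph (compose (padArities n) ub (proj S 2 zero) (padInner f)) xs y →
                 graph f (init xs) y
    drop-dummy ((y₀ ∷ _ ∷ []) , hs , refl) = subst (λ u → graph f u y₀) first-args (hs zero)

    add-dummy : graph f (init xs) y →
                graph (compose (padArities n) ub (proj S 2 zero) (padInner f)) xs y
    add-dummy fy = (y ∷ _ ∷ []) , (λ { zero → subst (λ u → graph f u y) (sym first-args) fy
                                      ; (suc zero) → refl }) , refl

  padding-function : BF S → Cm S → ∀ n →
    ∃ λ (s₂ : PFun 3) → IsV S 3 s₂ × ∃ λ π → ∃ λ π′ →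
      ∀ e → I n e → s₂ ⟨ π ∷ e ∷ π′ ∷ [] ⟩∈ (λ v → Index (suc n) v (padded (φ n e)))
  padding-function (proj-isV , _) cm n
    with cm 2 (padArities n) | proj-isV 2 zero | proj-isV (suc n) zero
  ... | s₂ , s₂-isV , spec | π , Iπ , π≃ | π′ , Iπ′ , π′≃ = s₂ , s₂-isV , π , π′ , padding
    where
    -- maxF 2 (padArities n) is n ⊔ (n+1), which is n+1 only propositionally
    padded-index : ∀ {M v} (f : PFun n) → M ≡ suc n → (ub : ∀ i → padArities n i ≤ M) →
                   Index M v (compose (padArities n) ub (proj S 2 zero) (padInner f)) →
                   Index (suc n) v (padded f)
    padded-index f refl ub (Iv , φv≃) =
      Iv , λ xs y → ⇔.trans (φv≃ xs y) (compose-padding f ub xs y)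

    inner : ℕ → Fin 2 → ℕ
    inner e zero    = e
    inner e (suc _) = π′

    padding : ∀ e → I n e → s₂ ⟨ π ∷ e ∷ π′ ∷ [] ⟩∈ (λ v → Index (suc n) v (padded (φ n e)))
    padding e Ie with spec π (inner e) Iπ (λ { zero → Ie ; (suc zero) → Iπ′ })
    ... | r , s₂r , Ir , φr≃ =
      r , s₂r , padded-index (φ n e) (m≤n⇒m⊔n≡n (n≤1+n n)) ub
                  (Ir , λ xs y → ⇔.trans (φr≃ xs y) (to-projections xs y))
      where
      ub : ∀ i → padArities n i ≤ maxF 2 (padArities n)
      ub = maxF-ub 2 (padArities n)
      to-projections : compose (padArities n) ub (φ 2 π) (λ i → φ (padArities n i) (inner e i)) ≃
                       compose (padArities n) ub (proj S 2 zero) (padInner (φ n e))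
      to-projections =
        compose-cong (padArities n) ub {f = φ 2 π} {f′ = proj S 2 zero}
          {gs = λ i → φ (padArities n i) (inner e i)} {gs′ = padInner (φ n e)} π≃ (λ { zero _ _ → ⇔.refl ; (suc zero) → π′≃ })

lemma2p2 : (S : Setting) → BF S → Cm S → Cn S → DV S
lemma2p2 S bf@(proj-isV , _) cm cn n with padding-function S bf cm n
... | s₂ , s₂-isV , π , π′ , s₂-pads = dv , dv-isV , dv-pads
  where
  open Setting S

  arguments : (i : Fin 3) → PFun 1
  arguments zero             = constF 1 π
  arguments (suc zero)       = proj S 1 zero
  arguments (suc (suc zero)) = constF 1 π′

  dv : PFun 1
  dv = compose (λ _ → 1) (maxF-ub 3 (λ _ → 1)) s₂ arguments

  dv-isV : IsV S 1 dv
  dv-isV = compose-isV S cm 3 (λ _ → 1) s₂ arguments s₂-isV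
    (λ { zero → constant-isV S bf cm cn π
       ; (suc zero) → proj-isV 1 zero
       ; (suc (suc zero)) → constant-isV S bf cm cn π′ })

  -- at e the arguments evaluate to (π, e, π′), where s₂ yields the padded index
  dv-pads : ∀ e → I n e → dv ⟨ e ∷ [] ⟩∈ (λ v → Index S (suc n) v (padded (φ n e)))
  dv-pads e Ie with s₂-pads e Ie
  ... | r , s₂r , r-index = r , ((π ∷ e ∷ π′ ∷ []) , arguments-at-e , s₂r) , r-index
    where
    arguments-at-e : ∀ i → graph (arguments i) (e ∷ []) (lookup (π ∷ e ∷ π′ ∷ []) i)
    arguments-at-e zero             = refl
    arguments-at-e (suc zero)       = refl
    arguments-at-e (suc (suc zero)) = refl
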